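{- Let $G=(V,E)$ be a connected locally connected graph and let $z,a,b$ be three distinct vertices such that $\overline{za}=\overline{zb}$. Then $d_G(a,b)=d_G(a,z)+d_G(z,b)$, i.e. $azb\in\mathcal{B}_G$.
   Context: A connected graph $G$ is locally connected if for every vertex $v$ the subgraph induced by its neighborhood $N(v)$ is connected. $d_G$ is the shortest-path distance. For distinct vertices $a,b$, the line $\overline{ab}$ is the set of vertices $c$ such that some shortest path contains $a,b,c$. The betweenness relation is $\mathcal{B}_G=\{(a,b,c)\in V^3 : |\{a,b,c\}|=3,\ d_G(a,c)=d_G(a,b)+d_G(b,c)\}$, and the triple $(a,b,c)$ is written $abc$. For a vertex $z$ and $u\neq z$, $[u]_z$ denotes the set of vertices $w\neq z$ with $\overline{zw}=\overline{zu}$; the hypothesis $[b]_z=[a]_z$ of the paper means $\overline{za}=\overline{zb}$. -}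

module Defs where

open import Level using (0ℓ)
open import Data.Nat using (ℕ; zero; suc; _+_; _≤_)
open import Data.Fin using (Fin)
open import Data.Product using (Σ; ∃; _×_; _,_)
open import Data.Sum using (_⊎_)
open import Data.Empty using (⊥)
open import Relation.Nullary using (¬_)
open import Relation.Binary.PropositionalEquality using (_≡_; _≢_)
open import Function.Bundles using (_⇔_)

record Graph : Set₁ where
  field
    n     : ℕ
    Adj   : Fin n → Fin n → Set
    sym   : ∀ {u v} → Adj u v → Adj v u
    irrefl : ∀ {u} → ¬ Adj u u

module _ (G : Graph) where
  open Graph G

  Vertex : Set
  Vertex = Fin n

  data Walk : Vertex → Vertex → ℕ → Set where
    here : ∀ {u} → Walk u u zero
    step : ∀ {u w v k} → Adj u w → Walk w v k → Walk u v (suc k)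

  -- Walks all of whose vertices satisfy P (used for induced subgraphs).
  data WalkIn (P : Vertex → Set) : Vertex → Vertex → Set where
    here : ∀ {u} → P u → WalkIn P u u
    step : ∀ {u w v} → P u → Adj u w → WalkIn P w v → WalkIn P u v

  Connected : Set
  Connected = ∀ u v → ∃ λ k → Walk u v k

  LocallyConnected : Set
  LocallyConnected = ∀ v x y → Adj v x → Adj v y → WalkIn (Adj v) x y

  Dist : Vertex → Vertex → ℕ → Set
  Dist u v k = Walk u v k × (∀ m → Walk u v m → k ≤ m)

  Between : Vertex → Vertex → Vertex → Set
  Between a b c =
    a ≢ b × b ≢ c × a ≢ c ×
    (∃ λ k → ∃ λ l → Dist a b k × Dist b c l × Dist a c (k + l))

  InLine : Vertex → Vertex → Vertex → Set
  InLine a b c = c ≡ a ⊎ c ≡ b ⊎ Between c a b ⊎ Between a c b ⊎ Between a b c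

  SameLine : Vertex → Vertex → Vertex → Vertex → Set
  SameLine a b c d = ∀ x → InLine a b x ⇔ InLine c d x

{-# OPTIONS --safe #-}
-- Since a lies on the line za = zb, either a z b holds or, up to swapping a and b,
-- a lies strictly between z and b, with k = d(z,a) and m = d(a,b) positive.  A neighbour p
-- of a towards z has d(p,b) > m and a neighbour a′ towards b has d(a′,b) < m; local
-- connectivity joins them by a path inside N(a), which therefore contains a vertex x with
-- d(x,b) = m.  As d(z,x) ∈ {k-1, k, k+1}, in each case x lies on exactly one of the lines
-- za and zb, a contradiction.  Distances exist only up to double negation (adjacency is not
-- decidable), which suffices because they are only used in proofs of ⊥.
module Submission where

open import Defs
open import Data.Nat using (ℕ; zero; suc; _+_; _≤_; _<_; z≤n; s≤s; z<s; _≤?_)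
open import Data.Nat.Properties
  using ( ≤-reflexive; ≤-antisym; ≤-trans; ≤-<-trans; <⇒≤; <⇒≢; ≮⇒≥; ≰⇒>; <-cmp
        ; m≤n⇒m≤1+n; m≤m+n; m≤n+m; m<m+n; m<n+m; +-cancelˡ-≤
        ; +-comm; +-suc; +-identityʳ; suc-injective; 0≢1+n; 1+n≢n )
open import Data.Nat.Induction using (<-rec)
open import Data.Fin using (_≟_)
open import Data.Product using (∃; _×_; _,_; proj₁; proj₂)
open import Data.Sum using (_⊎_; inj₁; inj₂)
open import Data.Empty using (⊥; ⊥-elim)
open import Relation.Nullary using (¬_; yes; no)
open import Relation.Binary using (tri<; tri≈; tri>)
open import Relation.Binary.PropositionalEquality
  using (_≡_; _≢_; ≢-sym; refl; sym; trans; cong; cong₂; subst)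
open import Function using (_∘_)
open import Function.Bundles using (_⇔_; mk⇔; Equivalence)
open import Function.Properties.Equivalence using () renaming (sym to ⇔-sym)

-- With D = d(u,v), s = d(u,x), t = d(x,v): the betweenness equations for x u v, u x v
-- and u v x.  They also cover x = u and x = v, so they characterise the line uv.
Collinear : ℕ → ℕ → ℕ → Set
Collinear D s t = t ≡ s + D ⊎ D ≡ s + t ⊎ s ≡ D + t

m≤1+n∧n≤1+m⇒1+n≡m∨n≡m∨n≡1+m : ∀ {m n} → m ≤ suc n → n ≤ suc m →
                               suc n ≡ m ⊎ n ≡ m ⊎ n ≡ suc m
m≤1+n∧n≤1+m⇒1+n≡m∨n≡m∨n≡1+m {m} {n} m≤1+n n≤1+m with <-cmp n m
... | tri< n<m _ _ = inj₁ (≤-antisym n<m m≤1+n)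
... | tri≈ _ n≡m _ = inj₂ (inj₁ n≡m)
... | tri> _ _ m<n = inj₂ (inj₂ (≤-antisym n≤1+m m<n))

1≢n+n : ∀ n → 1 ≢ n + n
1≢n+n (suc n) eq = 0≢1+n (trans (suc-injective eq) (+-suc n n))

-- The situation of a neighbour x of a with d(x,b) = d(a,b) = m when d(z,b) = d(z,a) + m,
-- s being d(z,x): x lies on exactly one of the lines za and zb.
collinear-neighbour-mismatch : ∀ {k m s} → 0 < m → k ≤ suc s → s ≤ suc k →
                               ¬ (Collinear k s 1 ⇔ Collinear (k + m) s m)
collinear-neighbour-mismatch {k} {m} {s} 0<m k≤1+s s≤1+k equiv
  with m≤1+n∧n≤1+m⇒1+n≡m∨n≡m∨n≡1+m k≤1+s s≤1+k
... | inj₁ refl = ¬collinear-closer (Equivalence.to equiv (inj₂ (inj₁ (+-comm 1 s))))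
  where
  ¬collinear-closer : ¬ Collinear (suc s + m) s m
  ¬collinear-closer (inj₁ eq) = <⇒≢ (≤-trans (m<n+m m z<s) (m≤n+m _ s)) eq
  ¬collinear-closer (inj₂ (inj₁ eq)) = 1+n≢n eq
  ¬collinear-closer (inj₂ (inj₂ eq)) = <⇒≢ (s≤s (≤-trans (m≤m+n s m) (m≤m+n (s + m) m))) eq
... | inj₂ (inj₁ refl) = ¬collinear-level (Equivalence.from equiv (inj₂ (inj₁ refl)))
  where
  ¬collinear-level : ¬ Collinear k k 1
  ¬collinear-level (inj₁ eq) = 1≢n+n k eq
  ¬collinear-level (inj₂ (inj₁ eq)) = <⇒≢ (m<m+n k z<s) eq
  ¬collinear-level (inj₂ (inj₂ eq)) = <⇒≢ (m<m+n k z<s) eq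
... | inj₂ (inj₂ refl) = ¬collinear-farther (Equivalence.to equiv (inj₂ (inj₂ (+-comm 1 k))))
  where
  ¬collinear-farther : ¬ Collinear (k + m) (suc k) m
  ¬collinear-farther (inj₁ eq) = <⇒≢ (s≤s (≤-trans (m≤n+m m k) (m≤n+m (k + m) k))) eq
  ¬collinear-farther (inj₂ (inj₁ eq)) = 1+n≢n (sym eq)
  ¬collinear-farther (inj₂ (inj₂ eq)) = <⇒≢ (≤-<-trans (m<m+n k 0<m) (m<m+n (k + m) 0<m)) eq

module _ (G : Graph) where
  open Graph G renaming (sym to Adj-sym)

  private
    variable
      u v w x z a b p : Vertex G
      i k l m s t D : ℕ
      P : Vertex G → Set

  infixr 5 _++_
  _++_ : Walk G u v k → Walk G v w l → Walk G u w (k + l)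
  here     ++ q = q
  step e p ++ q = step e (p ++ q)

  reverse : Walk G u v k → Walk G v u k
  reverse here = here
  reverse {k = suc k} (step e p) =
    subst (Walk G _ _) (+-comm k 1) (reverse p ++ step (Adj-sym e) here)

  dist-≤ : Dist G u v k → Walk G u v l → k ≤ l
  dist-≤ (_ , shortest) q = shortest _ q

  dist-unique : Dist G u v k → Dist G u v l → k ≡ l
  dist-unique d d′ = ≤-antisym (dist-≤ d (proj₁ d′)) (dist-≤ d′ (proj₁ d))

  dist-sym : Dist G u v k → Dist G v u k
  dist-sym (q , shortest) = reverse q , λ l r → shortest l (reverse r)

  dist-refl : Dist G u u 0
  dist-refl = here , λ _ _ → z≤n

  dist-adj : Adj u v → Dist G u v 1
  dist-adj e = step e here , λ where
    zero here → ⊥-elim (irrefl e)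
    (suc _) _ → s≤s z≤n

  dist-pos : u ≢ v → Dist G u v k → 0 < k
  dist-pos u≢v (here , _) = ⊥-elim (u≢v refl)
  dist-pos u≢v (step _ _ , _) = z<s

  dist-step : Adj u w → Dist G w v l → Dist G u v k → k ≤ suc l
  dist-step e dwv duv = dist-≤ duv (step e (proj₁ dwv))

  dist-exists : Walk G u v k → ¬ ¬ ∃ (Dist G u v)
  dist-exists {u} {v} q no-dist = <-rec (λ k → Walk G u v k → ⊥) shortest _ q
    where
    shortest : ∀ k → (∀ {j} → j < k → Walk G u v j → ⊥) → Walk G u v k → ⊥
    shortest k no-shorter r = no-dist (k , r , λ j r′ → ≮⇒≥ (λ j<k → no-shorter j<k r′))

  between-dist : Between G u v w → Dist G u v k → Dist G v w l → Dist G u w i → i ≡ k + l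
  between-dist (_ , _ , _ , _ , _ , duv , dvw , duw) d₁ d₂ d₃ =
    trans (dist-unique d₃ duw) (cong₂ _+_ (dist-unique duv d₁) (dist-unique dvw d₂))

  inLine⇒collinear : Dist G u v D → Dist G u x s → Dist G x v t →
                     InLine G u v x → Collinear D s t
  inLine⇒collinear {D = D} duv dux dxv (inj₁ refl) =
    inj₁ (trans (dist-unique dxv duv) (cong (_+ D) (dist-unique dist-refl dux)))
  inLine⇒collinear {D = D} duv dux dxv (inj₂ (inj₁ refl)) =
    inj₂ (inj₂ (trans (dist-unique dux duv)
                      (trans (sym (+-identityʳ D)) (cong (D +_) (dist-unique dist-refl dxv)))))
  inLine⇒collinear duv dux dxv (inj₂ (inj₂ (inj₁ xuv))) =
    inj₁ (between-dist xuv (dist-sym dux) duv dxv)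
  inLine⇒collinear duv dux dxv (inj₂ (inj₂ (inj₂ (inj₁ uxv)))) =
    inj₂ (inj₁ (between-dist uxv dux dxv duv))
  inLine⇒collinear duv dux dxv (inj₂ (inj₂ (inj₂ (inj₂ uvx)))) =
    inj₂ (inj₂ (between-dist uvx duv (dist-sym dxv) dux))

  collinear⇒inLine : u ≢ v → Dist G u v D → Dist G u x s → Dist G x v t →
                     Collinear D s t → InLine G u v x
  collinear⇒inLine {u} {v} {x = x} u≢v duv dux dxv col with x ≟ u | x ≟ v
  ... | yes x≡u | _ = inj₁ x≡u
  ... | no _ | yes x≡v = inj₂ (inj₁ x≡v)
  ... | no x≢u | no x≢v with col
  ...   | inj₁ t≡s+D =
    inj₂ (inj₂ (inj₁ (x≢u , u≢v , x≢v , _ , _ , dist-sym dux , duv , subst (Dist G x v) t≡s+D dxv)))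
  ...   | inj₂ (inj₁ D≡s+t) =
    inj₂ (inj₂ (inj₂ (inj₁ (≢-sym x≢u , x≢v , u≢v , _ , _ , dux , dxv , subst (Dist G u v) D≡s+t duv))))
  ...   | inj₂ (inj₂ s≡D+t) =
    inj₂ (inj₂ (inj₂ (inj₂ (u≢v , ≢-sym x≢v , ≢-sym x≢u , _ , _ , duv , dist-sym dxv , subst (Dist G u x) s≡D+t dux))))

  sameLine⇒collinear⇔ : SameLine G z a z b → z ≢ a → z ≢ b →
                        Dist G z a k → Dist G z b l → Dist G z x s → Dist G x a t → Dist G x b m →
                        Collinear k s t ⇔ Collinear l s m
  sameLine⇒collinear⇔ {x = x} same z≢a z≢b dza dzb dzx dxa dxb = mk⇔
    (inLine⇒collinear dzb dzx dxb ∘ Equivalence.to (same x) ∘ collinear⇒inLine z≢a dza dzx dxa)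
    (inLine⇒collinear dza dzx dxa ∘ Equivalence.from (same x) ∘ collinear⇒inLine z≢b dzb dzx dxb)

  -- A discrete intermediate value theorem: along an edge the distance to v changes by at most one.
  walkIn-intermediate-dist : Connected G → WalkIn G P u w → Dist G u v k → Dist G w v l →
                             l ≤ m → m ≤ k → ¬ ¬ ∃ λ x → P x × Dist G x v m
  walkIn-intermediate-dist {k = k} {m = m} conn (here Pu) duv duv′ l≤m m≤k found-none =
    found-none (_ , Pu , subst (Dist G _ _) k≡m duv)
    where
    k≡m : k ≡ m
    k≡m = ≤-antisym (≤-trans (≤-reflexive (dist-unique duv duv′)) l≤m) m≤k
  walkIn-intermediate-dist {v = v} {k = k} {m = m} conn (step {w = y} Pu e rest) duv dwv l≤m m≤k found-none =
    dist-exists (proj₂ (conn y v)) λ (j , dyv) → continue j dyv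
    where
    continue : ∀ j → Dist G y v j → ⊥
    continue j dyv with m ≤? j
    ... | yes m≤j = walkIn-intermediate-dist conn rest dyv dwv l≤m m≤j found-none
    ... | no m≰j = found-none (_ , Pu , subst (Dist G _ _) k≡m duv)
      where
      k≡m : k ≡ m
      k≡m = ≤-antisym (≤-trans (dist-step e dyv duv) (≰⇒> m≰j)) m≤k

  farther-neighbour : Connected G → a ≢ z → Walk G a z k → Dist G z b (k + m) →
                      ¬ ¬ ∃ λ p → Adj a p × ∃ λ j → Dist G p b j × m < j
  farther-neighbour conn a≢z here _ = λ _ → a≢z refl
  farther-neighbour {b = b} {m = m} conn _ (step {w = p} {k = k} e r) dzb found =
    dist-exists (proj₂ (conn p b)) λ (j , dpb) →
      found (p , e , j , dpb , +-cancelˡ-≤ k (suc m) j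
        (subst (_≤ k + j) (sym (+-suc k m)) (dist-≤ dzb (reverse r ++ proj₁ dpb))))

  level-neighbour : Connected G → LocallyConnected G → a ≢ b → Dist G a b m →
                    Adj a p → Dist G p b k → m ≤ k → ¬ ¬ ∃ λ x → Adj a x × Dist G x b m
  level-neighbour _ _ a≢b (here , _) _ _ _ = λ _ → a≢b refl
  level-neighbour conn lc _ (step e′ r , _) e dpb m≤k found =
    dist-exists r λ (_ , da′b) →
      walkIn-intermediate-dist conn (lc _ _ _ e e′) dpb da′b (m≤n⇒m≤1+n (dist-≤ da′b r)) m≤k found

  ¬between-on-sameLine : Connected G → LocallyConnected G → SameLine G z a z b → ¬ Between G z a b
  ¬between-on-sameLine {z} conn lc same (z≢a , a≢b , z≢b , k , m , dza , dab , dzb) =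
    farther-neighbour conn (≢-sym z≢a) (reverse (proj₁ dza)) dzb λ (p , a~p , j , dpb , m<j) →
    level-neighbour conn lc a≢b dab a~p dpb (<⇒≤ m<j) λ (x , a~x , dxb) →
    dist-exists (proj₂ (conn z x)) λ (s , dzx) →
    collinear-neighbour-mismatch (dist-pos a≢b dab)
      (dist-step a~x (dist-sym dzx) (dist-sym dza))
      (dist-step (Adj-sym a~x) (dist-sym dza) (dist-sym dzx))
      (sameLine⇒collinear⇔ same z≢a z≢b dza dzb dzx (dist-adj (Adj-sym a~x)) dxb)

lemma2p1 : (G : Graph) → Connected G → LocallyConnected G →
    (z a b : Vertex G) → z ≢ a → z ≢ b → a ≢ b →
    SameLine G z a z b →
    Between G a z b
lemma2p1 G conn lc z a b z≢a z≢b a≢b same with Equivalence.to (same a) (inj₂ (inj₁ refl))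
... | inj₁ a≡z = ⊥-elim (z≢a (sym a≡z))
... | inj₂ (inj₁ a≡b) = ⊥-elim (a≢b a≡b)
... | inj₂ (inj₂ (inj₁ azb)) = azb
... | inj₂ (inj₂ (inj₂ (inj₁ zab))) = ⊥-elim (¬between-on-sameLine G conn lc same zab)
... | inj₂ (inj₂ (inj₂ (inj₂ zba))) = ⊥-elim (¬between-on-sameLine G conn lc (⇔-sym ∘ same) zba)
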